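{- Let $G$ and $H$ be Left dead-ends with $G\geq_{\mathcal{M}}H$. Then the formal birthday of $G$ is at most the formal birthday of $H$.
   Context: Games are finite partizan games; the formal birthday of a game is the height of its game tree. Misère outcomes: $o^L(G)=\mathscr{L}$ iff $G$ has no Left option or some $o^R(G^L)=\mathscr{L}$ (else $\mathscr{R}$); $o^R(G)=\mathscr{R}$ iff $G$ has no Right option or some $o^L(G^R)=\mathscr{R}$ (else $\mathscr{L}$); $o(G)=\mathscr{L},\mathscr{N},\mathscr{P},\mathscr{R}$ for $(o^L,o^R)=(\mathscr{L},\mathscr{L}),(\mathscr{L},\mathscr{R}),(\mathscr{R},\mathscr{L}),(\mathscr{R},\mathscr{R})$, ordered $\mathscr{L}>\mathscr{N}>\mathscr{R}$, $\mathscr{L}>\mathscr{P}>\mathscr{R}$. Sum $G+H=\{G^L+H,G+H^L\mid G^R+H,G+H^R\}$. $G\geq_{\mathcal{M}}H$ means $o(G+X)\geq o(H+X)$ for all games $X$ (for Left dead-ends this coincides with the corresponding relation modulo any universe). A Left dead-end is a game all of whose subpositions have no Left option. -}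

module Defs where

open import Data.List using (List; []; _∷_; _++_)
open import Data.Nat using (ℕ; zero; suc; _⊔_)
open import Data.Bool using (Bool; true; false; _∨_; not)
open import Data.List.Relation.Unary.All using (All)

data Game : Set where
  ⟨_∣_⟩ : List Game → List Game → Game

LeftOpts : Game → List Game
LeftOpts ⟨ l ∣ r ⟩ = l

RightOpts : Game → List Game
RightOpts ⟨ l ∣ r ⟩ = r

mutual
  birthday : Game → ℕ
  birthday ⟨ l ∣ r ⟩ = maxB l ⊔ maxB r

  maxB : List Game → ℕ
  maxB [] = 0
  maxB (g ∷ gs) = suc (birthday g) ⊔ maxB gs

mutual
  _+G_ : Game → Game → Game
  ⟨ gl ∣ gr ⟩ +G ⟨ hl ∣ hr ⟩ =
    ⟨ addR gl ⟨ hl ∣ hr ⟩ ++ addL ⟨ gl ∣ gr ⟩ hl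
    ∣ addR gr ⟨ hl ∣ hr ⟩ ++ addL ⟨ gl ∣ gr ⟩ hr ⟩

  addR : List Game → Game → List Game
  addR [] h = []
  addR (g ∷ gs) h = (g +G h) ∷ addR gs h

  addL : Game → List Game → List Game
  addL g [] = []
  addL g (h ∷ hs) = (g +G h) ∷ addL g hs

-- We encode L and R as Bool: true = 𝓛, false = 𝓡.
-- oL G = 𝓛 iff G has no Left option or some Left option G^L has oR(G^L) = 𝓛.
-- oR G = 𝓡 iff G has no Right option or some Right option G^R has oL(G^R) = 𝓡.
mutual
  oL : Game → Bool
  oL ⟨ [] ∣ r ⟩ = true
  oL ⟨ g ∷ gs ∣ r ⟩ = anyL (g ∷ gs)

  anyL : List Game → Bool
  anyL [] = false
  anyL (g ∷ gs) = not (oRisR g) ∨ anyL gs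

  oRisR : Game → Bool
  oRisR ⟨ l ∣ [] ⟩ = true
  oRisR ⟨ l ∣ g ∷ gs ⟩ = anyR (g ∷ gs)

  anyR : List Game → Bool
  anyR [] = false
  anyR (g ∷ gs) = not (oL g) ∨ anyR gs

data Outcome : Set where
  𝓛 𝓝 𝓟 𝓡 : Outcome

outcome : Game → Outcome
outcome g with oL g | oRisR g
... | true  | false = 𝓛
... | true  | true  = 𝓝
... | false | false = 𝓟
... | false | true  = 𝓡

data _≤O_ : Outcome → Outcome → Set where
  refl≤ : ∀ {o} → o ≤O o
  R≤ : ∀ {o} → 𝓡 ≤O o
  ≤L : ∀ {o} → o ≤O 𝓛

_≥M_ : Game → Game → Set
G ≥M H = ∀ (X : Game) → outcome (H +G X) ≤O outcome (G +G X)

data LeftDeadEnd : Game → Set where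
  lde : ∀ {r} → All LeftDeadEnd r → LeftDeadEnd ⟨ [] ∣ r ⟩

-- Play G + X_k with X_0 = 0 and X_{k+1} = {X_k | 0}. In G + X_j with Right to move, Left can
-- only step down the ladder, and Right loses as soon as he moves X to 0 (Left is then out of
-- moves), so he wins exactly when G has a Right path of length j ending in a position
-- without Right moves: this holds if birthday G = j and fails if birthday G < j. For
-- k = birthday G + 1, Left moving first thus loses G + X_k but wins H + X_k whenever
-- birthday H < birthday G, contradicting G ≥ H.
module Submission where

open import Defs
open import Data.Nat using (ℕ; zero; suc; _≤_; _<_; s≤s⁻¹; pred)
open import Data.Nat.Properties using (m≤m⊔n; m≤n⊔m; <-≤-trans; ≤-trans; ⊔-sel; ≮⇒≥; n≮0)
open import Data.Bool as Bool using (Bool; true; false; not; b≤b)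
open import Data.Bool.Properties using (∨-identityʳ; ∨-zeroʳ; ≤-minimum; ≤-maximum)
open import Data.List using ([]; _∷_; _++_; map)
open import Data.List.Relation.Unary.All as All using (All; []; _∷_)
open import Data.List.Relation.Unary.All.Properties using (map⁺; ++⁺)
open import Data.List.Relation.Unary.Any using (Any; here; there)
open import Data.List.Relation.Unary.Any.Properties using (++⁺ˡ) renaming (map⁺ to Any-map⁺)
open import Data.List.Membership.Propositional using (_∈_; lose)
open import Data.Sum using (inj₁; inj₂)
open import Data.Product using (∃-syntax; _×_; _,_)
open import Function using (_∘_)
open import Relation.Nullary using (¬_; contradiction)
open import Relation.Binary.PropositionalEquality using (_≡_; refl; sym; trans; cong; subst; subst₂)

ladder : ℕ → Game
ladder zero    = ⟨ [] ∣ [] ⟩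
ladder (suc k) = ⟨ ladder k ∷ [] ∣ ⟨ [] ∣ [] ⟩ ∷ [] ⟩

addR≡map : ∀ gs h → addR gs h ≡ map (_+G h) gs
addR≡map []       h = refl
addR≡map (g ∷ gs) h = cong (g +G h ∷_) (addR≡map gs h)

maxB-bounds : ∀ gs → All (λ g → birthday g < maxB gs) gs
maxB-bounds []       = []
maxB-bounds (g ∷ gs) =
  m≤m⊔n _ (maxB gs) ∷ All.map (λ lt → ≤-trans lt (m≤n⊔m (suc (birthday g)) _)) (maxB-bounds gs)

maxB-attained : ∀ gs {i} → maxB gs ≡ suc i → ∃[ g ] g ∈ gs × birthday g ≡ i
maxB-attained (g ∷ gs) e with ⊔-sel (suc (birthday g)) (maxB gs)
... | inj₁ e′ = g , here refl , cong pred (trans (sym e′) e)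
... | inj₂ e′ with maxB-attained gs (trans (sym e′) e)
...   | g′ , g′∈gs , b≡i = g′ , there g′∈gs , b≡i

anyR-true : ∀ {gs} → Any (λ g → oL g ≡ false) gs → anyR gs ≡ true
anyR-true (here oL≡false) rewrite oL≡false = refl
anyR-true {g ∷ _} (there w) rewrite anyR-true w = ∨-zeroʳ (not (oL g))

anyR-false : ∀ {gs} → All (λ g → oL g ≡ true) gs → anyR gs ≡ false
anyR-false []               = refl
anyR-false (oL≡true ∷ rest) rewrite oL≡true = anyR-false rest

oRisR-true : ∀ {l rs} → Any (λ g → oL g ≡ false) rs → oRisR ⟨ l ∣ rs ⟩ ≡ true
oRisR-true {rs = _ ∷ _} = anyR-true

oRisR-false : ∀ {l} xs {y ys} → All (λ g → oL g ≡ true) (xs ++ y ∷ ys) →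
              oRisR ⟨ l ∣ xs ++ y ∷ ys ⟩ ≡ false
oRisR-false []      = anyR-false
oRisR-false (_ ∷ _) = anyR-false

oL-+ladder : ∀ r i → oL (⟨ [] ∣ r ⟩ +G ladder (suc i)) ≡ not (oRisR (⟨ [] ∣ r ⟩ +G ladder i))
oL-+ladder r i = ∨-identityʳ _

mutual
  rightFirst-loses : ∀ j {H} → LeftDeadEnd H → birthday H < j → oRisR (H +G ladder j) ≡ false
  rightFirst-loses (suc i) {⟨ [] ∣ r ⟩} (lde ps) bH<j =
    oRisR-false (addR r (ladder (suc i)))
      (++⁺ (subst (All _) (sym (addR≡map r (ladder (suc i))))
                 (map⁺ (All.zipWith option-wins (ps , maxB-bounds r))))
           (refl ∷ []))
    where
    option-wins : ∀ {h} → LeftDeadEnd h × birthday h < maxB r → oL (h +G ladder (suc i)) ≡ true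
    option-wins (dh , bh<bH) = leftFirst-wins i dh (<-≤-trans bh<bH (s≤s⁻¹ bH<j))

  leftFirst-wins : ∀ i {H} → LeftDeadEnd H → birthday H < i → oL (H +G ladder (suc i)) ≡ true
  leftFirst-wins i {⟨ [] ∣ r ⟩} dH bH<i =
    trans (oL-+ladder r i) (cong not (rightFirst-loses i dH bH<i))

mutual
  rightFirst-wins : ∀ j {G} → LeftDeadEnd G → birthday G ≡ j → oRisR (G +G ladder j) ≡ true
  rightFirst-wins zero    {⟨ [] ∣ [] ⟩}    _ _ = refl
  rightFirst-wins zero    {⟨ [] ∣ h ∷ hs ⟩} _ bG≡0 =
    contradiction (subst (birthday h <_) bG≡0 (All.head (maxB-bounds (h ∷ hs)))) n≮0
  rightFirst-wins (suc i) {⟨ [] ∣ r ⟩} (lde ps) bG≡j with maxB-attained r bG≡j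
  ... | g , g∈r , bg≡i =
    oRisR-true (++⁺ˡ (subst (Any _) (sym (addR≡map r (ladder (suc i))))
                              (Any-map⁺ (lose g∈r (leftFirst-loses i (All.lookup ps g∈r) bg≡i)))))

  leftFirst-loses : ∀ i {G} → LeftDeadEnd G → birthday G ≡ i → oL (G +G ladder (suc i)) ≡ false
  leftFirst-loses i {⟨ [] ∣ r ⟩} dG bG≡i =
    trans (oL-+ladder r i) (cong not (rightFirst-wins i dG bG≡i))

leftFirst : Outcome → Bool
leftFirst 𝓛 = true
leftFirst 𝓝 = true
leftFirst 𝓟 = false
leftFirst 𝓡 = false

leftFirst-outcome : ∀ g → leftFirst (outcome g) ≡ oL g
leftFirst-outcome g with oL g | oRisR g
... | true  | false = refl
... | true  | true  = refl
... | false | false = refl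
... | false | true  = refl

leftFirst-mono : ∀ {o o′} → o ≤O o′ → leftFirst o Bool.≤ leftFirst o′
leftFirst-mono refl≤ = b≤b
leftFirst-mono R≤    = ≤-minimum _
leftFirst-mono ≤L    = ≤-maximum _

oL-mono : ∀ g h → outcome g ≤O outcome h → oL g Bool.≤ oL h
oL-mono g h = subst₂ Bool._≤_ (leftFirst-outcome g) (leftFirst-outcome h) ∘ leftFirst-mono

proposition3p3 : (G H : Game) → LeftDeadEnd G → LeftDeadEnd H → G ≥M H →
    birthday G ≤ birthday H
proposition3p3 G H dG dH G≥H = ≮⇒≥ λ bH<bG →
  true≰false (subst₂ Bool._≤_ (leftFirst-wins (birthday G) dH bH<bG)
                              (leftFirst-loses (birthday G) dG refl)
                              (oL-mono (H +G X) (G +G X) (G≥H X)))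
  where
  X : Game
  X = ladder (suc (birthday G))

  true≰false : ¬ (true Bool.≤ false)
  true≰false ()
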